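{- Let $(a_1,\dots,a_k)$ be a sequence of nonnegative integers and $1\le j\le k$. There is a bijection between $D_j(a_1,\dots,a_k)$ and $D_j^*(a_1,\dots,a_{j-1},a_j+1,a_{j+1},\dots,a_k)$.
   Context: For a sequence $\mathbf a=(a_1,\dots,a_k)$ of nonnegative integers with sum $n$, put $c_j=a_1+\dots+a_j$ ($c_0=0$) and blocks $A_j=\{c_{j-1}+1,\dots,c_j\}$. $S_{\mathbf a}$ is the set of permutations $\pi$ of $[n]$ with $\pi_i>\pi_{i+1}$ whenever $i,i+1$ lie in the same block. $D_j(\mathbf a)$ is the set of $\pi\in S_{\mathbf a}$ having no fixed point (i.e. no $i$ with $\pi_i=i$) in $A_1\cup\dots\cup A_j$. $D_j^*(\mathbf a)$ is the set of $\pi\in S_{\mathbf a}$ having no fixed point in $A_1\cup\dots\cup A_{j-1}$ but having a fixed point in $A_j$. -}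

module Defs where

open import Data.Nat using (ℕ; zero; suc; _<_; _≤_; _<ᵇ_; _∸_)
open import Data.Nat.Properties using (<-trans; n<1+n)
open import Data.Bool using (if_then_else_)
open import Data.Fin as Fin using (Fin; toℕ; fromℕ<)
open import Data.Vec using (Vec; []; _∷_; lookup; sum; updateAt)
open import Data.Product using (Σ; Σ-syntax; ∃-syntax; _×_; proj₁)
open import Relation.Binary.PropositionalEquality using (_≡_)
open import Relation.Nullary using (¬_)

-- Positions are 0-indexed: position p ∈ {0,…,n-1} stands for p+1 ∈ [n];
-- values likewise (a permutation is a word π : Vec (Fin n) n).
-- Blocks are 0-indexed too: block b stands for A_{b+1}.

-- index (0-based) of the block containing position p (for p < sum a);
-- empty blocks are skipped automatically.
blockOf : ∀ {k} → Vec ℕ k → ℕ → ℕ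
blockOf []       p = 0
blockOf (x ∷ xs) p = if p <ᵇ x then 0 else suc (blockOf xs (p ∸ x))

IsPerm : ∀ {n} → Vec (Fin n) n → Set
IsPerm {n} π = ∀ (i j : Fin n) → lookup π i ≡ lookup π j → i ≡ j

Descending : ∀ {k} (a : Vec ℕ k) → Vec (Fin (sum a)) (sum a) → Set
Descending a π =
  ∀ (i : ℕ) (h : suc i < sum a) →
  blockOf a i ≡ blockOf a (suc i) →
  lookup π (fromℕ< h) Fin.< lookup π (fromℕ< (<-trans (n<1+n i) h))

InS : ∀ {k} (a : Vec ℕ k) → Vec (Fin (sum a)) (sum a) → Set
InS a π = IsPerm π × Descending a π

FixedAt : ∀ {n} → Vec (Fin n) n → Fin n → Set
FixedAt π i = lookup π i ≡ i

-- D_j(a) : no fixed point in A_1 ∪ … ∪ A_j   (j given 0-indexed as j : Fin k)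
InD : ∀ {k} (a : Vec ℕ k) (j : Fin k) → Vec (Fin (sum a)) (sum a) → Set
InD a j π = InS a π × (∀ i → blockOf a (toℕ i) ≤ toℕ j → ¬ FixedAt π i)

-- D*_j(a) : no fixed point in A_1 ∪ … ∪ A_{j-1}, some fixed point in A_j
InD* : ∀ {k} (a : Vec ℕ k) (j : Fin k) → Vec (Fin (sum a)) (sum a) → Set
InD* a j π =
  InS a π ×
  (∀ i → blockOf a (toℕ i) < toℕ j → ¬ FixedAt π i) ×
  (∃[ i ] (blockOf a (toℕ i) ≡ toℕ j × FixedAt π i))

Subset : ∀ {n} → (Vec (Fin n) n → Set) → Set
Subset {n} P = Σ[ π ∈ Vec (Fin n) n ] P π

-- a bijection between two such subsets: mutually inverse maps, where elements
-- are compared by the underlying permutation (membership proofs are irrelevant)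
record Bij {m n : ℕ} (P : Vec (Fin m) m → Set) (Q : Vec (Fin n) n → Set) : Set where
  field
    to      : Subset P → Subset Q
    from    : Subset Q → Subset P
    from∘to : ∀ x → proj₁ (from (to x)) ≡ proj₁ x
    to∘from : ∀ y → proj₁ (to (from y)) ≡ proj₁ y

incAt : ∀ {k} → Vec ℕ k → Fin k → Vec ℕ k
incAt a j = updateAt a j suc

module Submission where

-- Let block j of a occupy the positions [c, c + m); in a′ block j is [c, c + m].
-- For π ∈ D_j(a) the entries in block j decrease strictly while the positions increase, so
-- "π_i > i" holds on an initial segment [c, Q) of the block and fails (with π_i < i, as there is
-- no fixed point) from Q on; this Q ∈ [c, c + m] is the *slot* of π.  Inserting a new fixed point
-- at position Q (shifting the other positions and values around it) produces σ ∈ D*_j(a′): the slot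
-- conditions are exactly what keeps σ descending on both sides of Q.  Conversely, a descending
-- σ ∈ D*_j(a′) has exactly one fixed point q in its block j, and deleting it gives π ∈ D_j(a)
-- whose slot is q; so the two constructions are mutually inverse.

open import Defs
open import Data.Bool using (true; false; T)
open import Data.Empty using (⊥-elim)
open import Data.Fin as Fin using (Fin; toℕ; fromℕ<; punchIn; punchOut)
open import Data.Fin.Properties
  using (toℕ-fromℕ<; toℕ-injective; toℕ<n; punchIn-punchOut; punchIn-mono-≤; punchIn-cancel-≤;
         punchIn-injective; punchInᵢ≢i)
open import Data.Nat using (ℕ; zero; suc; _+_; _<_; _≤_; _≮_; _<ᵇ_; z≤n; s≤s; _<?_)
open import Data.Nat.Properties
open import Data.Product using (∃; _×_; _,_; proj₁; proj₂)
open import Data.Sum using (_⊎_; inj₁; inj₂)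
open import Data.Vec using (Vec; []; _∷_; lookup; sum; map; tabulate; insertAt)
open import Data.Vec.Properties
  using (lookup-map; lookup∘tabulate; tabulate-cong; tabulate∘lookup; insertAt-lookup; insertAt-punchIn)
open import Relation.Binary.PropositionalEquality
open import Relation.Nullary using (¬_; Dec; yes; no)

blockOf-head : ∀ {k} x (xs : Vec ℕ k) p → p < x → blockOf (x ∷ xs) p ≡ 0
blockOf-head x xs p p<x with p <ᵇ x | <⇒<ᵇ p<x
... | true  | _ = refl
... | false | ()

blockOf-tail : ∀ {k} x (xs : Vec ℕ k) p → blockOf (x ∷ xs) (x + p) ≡ suc (blockOf xs p)
blockOf-tail x xs p with (x + p) <ᵇ x in eq
... | true  = ⊥-elim (<⇒≱ (<ᵇ⇒< (x + p) x (subst T (sym eq) _)) (m≤m+n x p))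
... | false = cong (λ q → suc (blockOf xs q)) (m+n∸m≡n x p)

below-or-beyond : ∀ x i → i < x ⊎ ∃ λ i′ → i ≡ x + i′
below-or-beyond x i with i <? x
... | yes i<x = inj₁ i<x
... | no  i≮x with m≤n⇒∃[o]m+o≡n (≮⇒≥ i≮x)
...   | i′ , eq = inj₂ (i′ , sym eq)

blockStart : ∀ {k} → Vec ℕ k → Fin k → ℕ
blockStart (x ∷ xs) Fin.zero    = 0
blockStart (x ∷ xs) (Fin.suc j) = x + blockStart xs j

blockOf-inside : ∀ {k} (a : Vec ℕ k) j p → blockStart a j ≤ p → p < blockStart a j + lookup a j →
                 blockOf a p ≡ toℕ j
blockOf-inside (x ∷ xs) Fin.zero    p _  p<x = blockOf-head x xs p p<x
blockOf-inside (x ∷ xs) (Fin.suc j) p s≤p p<e with below-or-beyond x p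
... | inj₁ p<x = ⊥-elim (<⇒≱ p<x (≤-trans (m≤m+n x _) s≤p))
... | inj₂ (p′ , refl) = trans (blockOf-tail x xs p′) (cong suc (blockOf-inside xs j p′
        (+-cancelˡ-≤ x _ _ s≤p) (+-cancelˡ-< x _ _ (subst (x + p′ <_) (+-assoc x _ _) p<e))))

blockOf-range : ∀ {k} (a : Vec ℕ k) j p → blockOf a p ≡ toℕ j →
                blockStart a j ≤ p × p < blockStart a j + lookup a j
blockOf-range (x ∷ xs) j p eq with below-or-beyond x p | j
... | inj₁ p<x          | Fin.zero  = z≤n , p<x
... | inj₁ p<x          | Fin.suc j′ with () ← trans (sym (blockOf-head x xs p p<x)) eq
... | inj₂ (p′ , refl) | Fin.zero  with () ← trans (sym (blockOf-tail x xs p′)) eq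
... | inj₂ (p′ , refl) | Fin.suc j′
  with s≤p′ , p′<e ← blockOf-range xs j′ p′ (suc-injective (trans (sym (blockOf-tail x xs p′)) eq)) =
  +-monoʳ-≤ x s≤p′ , subst (x + p′ <_) (sym (+-assoc x _ _)) (+-monoʳ-< x p′<e)

blockOf-mono : ∀ {k} (a : Vec ℕ k) {p q} → p ≤ q → blockOf a p ≤ blockOf a q
blockOf-mono []       p≤q = ≤-refl
blockOf-mono (x ∷ xs) {p} {q} p≤q with below-or-beyond x p | below-or-beyond x q
... | inj₁ p<x | _ rewrite blockOf-head x xs p p<x = z≤n
... | inj₂ (p′ , refl) | inj₁ q<x = ⊥-elim (<⇒≱ q<x (≤-trans (m≤m+n x p′) p≤q))
... | inj₂ (p′ , refl) | inj₂ (q′ , refl)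
  rewrite blockOf-tail x xs p′ | blockOf-tail x xs q′ = s≤s (blockOf-mono xs (+-cancelˡ-≤ x _ _ p≤q))

blockEnd≤sum : ∀ {k} (a : Vec ℕ k) j → blockStart a j + lookup a j ≤ sum a
blockEnd≤sum (x ∷ xs) Fin.zero    = m≤m+n x _
blockEnd≤sum (x ∷ xs) (Fin.suc j) =
  subst (_≤ x + sum xs) (sym (+-assoc x _ _)) (+-monoʳ-≤ x (blockEnd≤sum xs j))

sum-incAt : ∀ {k} (a : Vec ℕ k) j → sum (incAt a j) ≡ suc (sum a)
sum-incAt (x ∷ xs) Fin.zero    = refl
sum-incAt (x ∷ xs) (Fin.suc j) = trans (cong (x +_) (sum-incAt xs j)) (+-suc x _)

blockStart-incAt : ∀ {k} (a : Vec ℕ k) j → blockStart (incAt a j) j ≡ blockStart a j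
blockStart-incAt (x ∷ xs) Fin.zero    = refl
blockStart-incAt (x ∷ xs) (Fin.suc j) = cong (x +_) (blockStart-incAt xs j)

lookup-incAt : ∀ {k} (a : Vec ℕ k) j → lookup (incAt a j) j ≡ suc (lookup a j)
lookup-incAt (x ∷ xs) Fin.zero    = refl
lookup-incAt (x ∷ xs) (Fin.suc j) = lookup-incAt xs j

blockEnd-incAt : ∀ {k} (a : Vec ℕ k) j →
                 blockStart (incAt a j) j + lookup (incAt a j) j ≡ suc (blockStart a j + lookup a j)
blockEnd-incAt a j = trans (cong₂ _+_ (blockStart-incAt a j) (lookup-incAt a j)) (+-suc _ _)

incAt-block-inside : ∀ {k} (a : Vec ℕ k) j p → blockStart a j ≤ p → p ≤ blockStart a j + lookup a j →
                     blockOf (incAt a j) p ≡ toℕ j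
incAt-block-inside a j p s≤p p≤e = blockOf-inside (incAt a j) j p
  (subst (_≤ p) (sym (blockStart-incAt a j)) s≤p) (subst (p <_) (sym (blockEnd-incAt a j)) (s≤s p≤e))

incAt-block-range : ∀ {k} (a : Vec ℕ k) j p → blockOf (incAt a j) p ≡ toℕ j →
                    blockStart a j ≤ p × p ≤ blockStart a j + lookup a j
incAt-block-range a j p p∈j with blockOf-range (incAt a j) j p p∈j
... | s≤p , p<e = subst (_≤ p) (blockStart-incAt a j) s≤p , ≤-pred (subst (p <_) (blockEnd-incAt a j) p<e)

blockOf-incAt-before : ∀ {k} (a : Vec ℕ k) j i → i < blockStart a j + lookup a j →
                       blockOf (incAt a j) i ≡ blockOf a i
blockOf-incAt-before (x ∷ xs) Fin.zero i i<e =
  trans (blockOf-head (suc x) xs i (m<n⇒m<1+n i<e)) (sym (blockOf-head x xs i i<e))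
blockOf-incAt-before (x ∷ xs) (Fin.suc j) i i<e with below-or-beyond x i
... | inj₁ i<x = trans (blockOf-head x (incAt xs j) i i<x) (sym (blockOf-head x xs i i<x))
... | inj₂ (i′ , refl) = begin
  blockOf (x ∷ incAt xs j) (x + i′) ≡⟨ blockOf-tail x (incAt xs j) i′ ⟩
  suc (blockOf (incAt xs j) i′)      ≡⟨ cong suc (blockOf-incAt-before xs j i′
                                          (+-cancelˡ-< x _ _ (subst (x + i′ <_) (+-assoc x _ _) i<e))) ⟩
  suc (blockOf xs i′)                ≡⟨ blockOf-tail x xs i′ ⟨
  blockOf (x ∷ xs) (x + i′)          ∎
  where open ≡-Reasoning

blockOf-incAt-after : ∀ {k} (a : Vec ℕ k) j i → blockStart a j ≤ i →
                      blockOf (incAt a j) (suc i) ≡ blockOf a i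
blockOf-incAt-after (x ∷ xs) Fin.zero i _ with below-or-beyond x i
... | inj₁ i<x = trans (blockOf-head (suc x) xs (suc i) (s≤s i<x)) (sym (blockOf-head x xs i i<x))
... | inj₂ (i′ , refl) = trans (blockOf-tail (suc x) xs i′) (sym (blockOf-tail x xs i′))
blockOf-incAt-after (x ∷ xs) (Fin.suc j) i s≤i with below-or-beyond x i
... | inj₁ i<x = ⊥-elim (<⇒≱ i<x (≤-trans (m≤m+n x _) s≤i))
... | inj₂ (i′ , refl) = begin
  blockOf (x ∷ incAt xs j) (suc (x + i′)) ≡⟨ cong (blockOf (x ∷ incAt xs j)) (+-suc x i′) ⟨
  blockOf (x ∷ incAt xs j) (x + suc i′)   ≡⟨ blockOf-tail x (incAt xs j) (suc i′) ⟩
  suc (blockOf (incAt xs j) (suc i′))      ≡⟨ cong suc (blockOf-incAt-after xs j i′ (+-cancelˡ-≤ x _ _ s≤i)) ⟩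
  suc (blockOf xs i′)                      ≡⟨ blockOf-tail x xs i′ ⟨
  blockOf (x ∷ xs) (x + i′)                ∎
  where open ≡-Reasoning

-- π descends across adjacent positions carrying the same label b;
-- for b = blockOf a this is, definitionally, Defs.Descending a.
DescendingBy : (ℕ → ℕ) → ∀ {N} → Vec (Fin N) N → Set
DescendingBy b {N} π =
  ∀ (i : ℕ) (h : suc i < N) →
  b i ≡ b (suc i) →
  lookup π (fromℕ< h) Fin.< lookup π (fromℕ< (<-trans (n<1+n i) h))

DescendsAdjacent : (ℕ → ℕ) → ∀ {N} → Vec (Fin N) N → Set
DescendsAdjacent b {N} σ =
  ∀ (x y : Fin N) → toℕ y ≡ suc (toℕ x) → b (toℕ x) ≡ b (toℕ y) → lookup σ y Fin.< lookup σ x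

fromℕ<≡ : ∀ {N} (y : Fin N) {i} .(h : i < N) → toℕ y ≡ i → fromℕ< h ≡ y
fromℕ<≡ y h eq = toℕ-injective (trans (toℕ-fromℕ< h) (sym eq))

descending⇒adjacent : ∀ b {N} (σ : Vec (Fin N) N) → DescendingBy b σ → DescendsAdjacent b σ
descending⇒adjacent b {N} σ desc x y y≡x+1 same =
  subst₂ (λ u v → lookup σ u Fin.< lookup σ v) (fromℕ<≡ y h y≡x+1) (fromℕ<≡ x _ refl)
    (desc (toℕ x) h (trans same (cong b y≡x+1)))
  where h = subst (_< N) y≡x+1 (toℕ<n y)

adjacent⇒descending : ∀ b {N} (σ : Vec (Fin N) N) → DescendsAdjacent b σ → DescendingBy b σ
adjacent⇒descending b {N} σ adj i h same =
  adj (fromℕ< h′) (fromℕ< h) (trans (toℕ-fromℕ< h) (cong suc (sym (toℕ-fromℕ< h′))))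
    (subst₂ (λ u v → b u ≡ b v) (sym (toℕ-fromℕ< h′)) (sym (toℕ-fromℕ< h)) same)
  where h′ = <-trans (n<1+n i) h

-- The entries of a vector as natural numbers at natural positions (0 beyond the end);
-- this lets arithmetic on positions and values happen in ℕ.
val : ∀ {N m} → Vec (Fin N) m → ℕ → ℕ
val []       _       = 0
val (x ∷ xs) zero    = toℕ x
val (x ∷ xs) (suc i) = val xs i

val-lookup : ∀ {N m} (v : Vec (Fin N) m) (x : Fin m) → val v (toℕ x) ≡ toℕ (lookup v x)
val-lookup (v ∷ vs) Fin.zero    = refl
val-lookup (v ∷ vs) (Fin.suc x) = val-lookup vs x

val-fromℕ< : ∀ {N m} (v : Vec (Fin N) m) {i} .(h : i < m) → val v i ≡ toℕ (lookup v (fromℕ< h))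
val-fromℕ< v h = trans (cong (val v) (sym (toℕ-fromℕ< h))) (val-lookup v (fromℕ< h))

descending-step : ∀ b {N} (σ : Vec (Fin N) N) → DescendingBy b σ →
                  ∀ i → suc i < N → b i ≡ b (suc i) → val σ (suc i) < val σ i
descending-step b σ desc i h same =
  subst₂ _<_ (sym (val-fromℕ< σ h)) (sym (val-fromℕ< σ (<-trans (n<1+n i) h))) (desc i h same)

run-antitone : ∀ (f : ℕ → ℕ) lo hi → (∀ i → lo ≤ i → suc i ≤ hi → f (suc i) < f i) →
               ∀ x y → lo ≤ x → x < y → y ≤ hi → f y < f x
run-antitone f lo hi step x (suc y) lo≤x (s≤s x≤y) y<hi with m≤n⇒m<n∨m≡n x≤y
... | inj₁ x<y  = <-trans (step y (≤-trans lo≤x x≤y) y<hi) (run-antitone f lo hi step x y lo≤x x<y (<⇒≤ y<hi))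
... | inj₂ refl = step x lo≤x y<hi

first-or-end : ∀ (P : ℕ → Set) → (∀ i → Dec (P i)) → ∀ r lo →
  ∃ λ Q → lo ≤ Q × Q ≤ r + lo × (∀ i → lo ≤ i → i < Q → ¬ P i) × (Q < r + lo → P Q)
first-or-end P P? zero lo =
  lo , ≤-refl , ≤-refl , (λ i lo≤i i<lo → ⊥-elim (<⇒≱ i<lo lo≤i)) , (λ lo<lo → ⊥-elim (<-irrefl refl lo<lo))
first-or-end P P? (suc r) lo with P? lo
... | yes P-lo = lo , ≤-refl , m≤n+m lo (suc r) , (λ i lo≤i i<lo → ⊥-elim (<⇒≱ i<lo lo≤i)) , (λ _ → P-lo)
... | no ¬P-lo with first-or-end P P? r (suc lo)
...   | Q , lo<Q , Q≤end , before , at =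
  Q , <⇒≤ lo<Q , subst (Q ≤_) (+-suc r lo) Q≤end , before′ , (λ Q<end → at (subst (Q <_) (sym (+-suc r lo)) Q<end))
  where
    before′ : ∀ i → lo ≤ i → i < Q → ¬ P i
    before′ i lo≤i i<Q with m≤n⇒m<n∨m≡n lo≤i
    ... | inj₁ lo<i = before i lo<i i<Q
    ... | inj₂ refl = ¬P-lo

punchIn-cases : ∀ {n} (i : Fin (suc n)) (o : Fin n) →
  (toℕ o < toℕ i × toℕ (punchIn i o) ≡ toℕ o) ⊎ (toℕ i ≤ toℕ o × toℕ (punchIn i o) ≡ suc (toℕ o))
punchIn-cases Fin.zero    o           = inj₂ (z≤n , refl)
punchIn-cases (Fin.suc i) Fin.zero    = inj₁ (s≤s z≤n , refl)
punchIn-cases (Fin.suc i) (Fin.suc o) with punchIn-cases i o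
... | inj₁ (o<i , eq) = inj₁ (s≤s o<i , cong suc eq)
... | inj₂ (i≤o , eq) = inj₂ (s≤s i≤o , cong suc eq)

punchIn-low : ∀ {n} (i : Fin (suc n)) o → toℕ o < toℕ i → toℕ (punchIn i o) ≡ toℕ o
punchIn-low i o o<i with punchIn-cases i o
... | inj₁ (_ , eq)   = eq
... | inj₂ (i≤o , _) = ⊥-elim (<⇒≱ o<i i≤o)

punchIn-high : ∀ {n} (i : Fin (suc n)) o → toℕ i ≤ toℕ o → toℕ (punchIn i o) ≡ suc (toℕ o)
punchIn-high i o i≤o with punchIn-cases i o
... | inj₁ (o<i , _) = ⊥-elim (<⇒≱ o<i i≤o)
... | inj₂ (_ , eq)   = eq

punchIn-below : ∀ {n} (i : Fin (suc n)) o → toℕ o < toℕ i → toℕ (punchIn i o) < toℕ i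
punchIn-below i o o<i = subst (_< toℕ i) (sym (punchIn-low i o o<i)) o<i

punchIn-below⁻¹ : ∀ {n} (i : Fin (suc n)) o → toℕ (punchIn i o) < toℕ i → toℕ o < toℕ i
punchIn-below⁻¹ i o p<i with punchIn-cases i o
... | inj₁ (o<i , _) = o<i
... | inj₂ (i≤o , eq) = ⊥-elim (<⇒≱ p<i (≤-trans i≤o (≤-trans (n≤1+n _) (≤-reflexive (sym eq)))))

punchIn-above : ∀ {n} (i : Fin (suc n)) o → toℕ i ≤ toℕ o → toℕ i < toℕ (punchIn i o)
punchIn-above i o i≤o = subst (toℕ i <_) (sym (punchIn-high i o i≤o)) (s≤s i≤o)

punchIn-above⁻¹ : ∀ {n} (i : Fin (suc n)) o → toℕ i < toℕ (punchIn i o) → toℕ i ≤ toℕ o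
punchIn-above⁻¹ i o i<p with punchIn-cases i o
... | inj₁ (o<i , eq) = ⊥-elim (<-asym i<p (subst (_< toℕ i) (sym eq) o<i))
... | inj₂ (i≤o , _) = i≤o

punchIn-mono-< : ∀ {n} (i : Fin (suc n)) (u v : Fin n) → u Fin.< v → punchIn i u Fin.< punchIn i v
punchIn-mono-< i u v u<v = ≰⇒> (λ pv≤pu → <⇒≱ u<v (punchIn-cancel-≤ i v u pv≤pu))

punchIn-cancel-< : ∀ {n} (i : Fin (suc n)) (u v : Fin n) → punchIn i u Fin.< punchIn i v → u Fin.< v
punchIn-cancel-< i u v pu<pv = ≰⇒> (λ v≤u → <⇒≱ pu<pv (punchIn-mono-≤ i v u v≤u))

punchIn-before-pivot : ∀ {n} (i : Fin (suc n)) x → toℕ i ≡ suc (toℕ (punchIn i x)) → toℕ (punchIn i x) ≡ toℕ x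
punchIn-before-pivot i x i≡px+1 =
  punchIn-low i x (punchIn-below⁻¹ i x (≤-reflexive (sym i≡px+1)))

punchIn-after-pivot : ∀ {n} (i : Fin (suc n)) y → toℕ (punchIn i y) ≡ suc (toℕ i) → toℕ y ≡ toℕ i
punchIn-after-pivot i y py≡i+1 =
  suc-injective (trans (sym (punchIn-high i y i≤y)) py≡i+1)
  where i≤y = punchIn-above⁻¹ i y (≤-reflexive (sym py≡i+1))

punchIn-adjacent : ∀ {n} (i : Fin (suc n)) (x y : Fin n) → toℕ y ≡ suc (toℕ x) →
  toℕ (punchIn i y) ≡ suc (toℕ (punchIn i x)) ⊎
  (suc (toℕ (punchIn i x)) ≡ toℕ i × toℕ (punchIn i y) ≡ suc (toℕ i))
punchIn-adjacent i x y y≡x+1 with punchIn-cases i x | punchIn-cases i y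
... | inj₁ (_ , ex) | inj₁ (_ , ey) = inj₁ (trans ey (trans y≡x+1 (cong suc (sym ex))))
... | inj₂ (_ , ex) | inj₂ (_ , ey) = inj₁ (trans ey (trans (cong suc y≡x+1) (cong suc (sym ex))))
... | inj₁ (x<i , ex) | inj₂ (i≤y , ey) =
  inj₂ (trans (cong suc ex) (sym i≡x+1) , trans ey (cong suc (trans y≡x+1 (sym i≡x+1))))
  where i≡x+1 = ≤-antisym (subst (toℕ i ≤_) y≡x+1 i≤y) x<i
... | inj₂ (i≤x , _) | inj₁ (y<i , _) =
  ⊥-elim (<-asym y<i (≤-<-trans i≤x (subst (toℕ x <_) (sym y≡x+1) (n<1+n _))))

punchIn-adjacent⁻¹ : ∀ {n} (i : Fin (suc n)) (x y : Fin n) →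
  toℕ (punchIn i y) ≡ suc (toℕ (punchIn i x)) → toℕ y ≡ suc (toℕ x)
punchIn-adjacent⁻¹ i x y adj with punchIn-cases i x | punchIn-cases i y
... | inj₁ (_ , ex) | inj₁ (_ , ey) = trans (sym ey) (trans adj (cong suc ex))
... | inj₂ (_ , ex) | inj₂ (_ , ey) = suc-injective (trans (sym ey) (trans adj (cong suc ex)))
... | inj₁ (x<i , ex) | inj₂ (i≤y , ey) =
  ⊥-elim (<⇒≱ x<i (subst (toℕ i ≤_) (suc-injective (trans (sym ey) (trans adj (cong suc ex)))) i≤y))
... | inj₂ (i≤x , ex) | inj₁ (y<i , ey) =
  ⊥-elim (<⇒≱ y<i (≤-trans i≤x (≤-trans (n≤1+n _) (≤-trans (n≤1+n _)
    (≤-reflexive (sym (trans (sym ey) (trans adj (cong suc ex)))))))))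

pivot-or-punched : ∀ {n} (i x : Fin (suc n)) → x ≡ i ⊎ ∃ λ x′ → x ≡ punchIn i x′
pivot-or-punched i x with x Fin.≟ i
... | yes x≡i = inj₁ x≡i
... | no  x≢i = inj₂ (punchOut (λ i≡x → x≢i (sym i≡x)) , sym (punchIn-punchOut _))

lookup-ext : ∀ {A : Set} {n} (u v : Vec A n) → (∀ x → lookup u x ≡ lookup v x) → u ≡ v
lookup-ext u v same = trans (sym (tabulate∘lookup u)) (trans (tabulate-cong same) (tabulate∘lookup v))

record InsertsFixed {n} (i : Fin (suc n)) (π : Vec (Fin n) n) (σ : Vec (Fin (suc n)) (suc n)) : Set where
  constructor inserting
  field
    fix   : FixedAt σ i
    shift : ∀ x → lookup σ (punchIn i x) ≡ punchIn i (lookup π x)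

insertFixed : ∀ {n} → Fin (suc n) → Vec (Fin n) n → Vec (Fin (suc n)) (suc n)
insertFixed i π = insertAt (map (punchIn i) π) i i

insertFixed-inserts : ∀ {n} (i : Fin (suc n)) π → InsertsFixed i π (insertFixed i π)
insertFixed-inserts i π =
  inserting (insertAt-lookup _ i i) λ x → trans (insertAt-punchIn _ i i x) (lookup-map x (punchIn i) π)

avoids-fixed : ∀ {n} {i : Fin (suc n)} σ → IsPerm σ → FixedAt σ i → ∀ x → i ≢ lookup σ (punchIn i x)
avoids-fixed {i = i} σ perm fix x i≡σx = punchInᵢ≢i i x (perm _ _ (trans (sym i≡σx) (sym fix)))

removeFixed : ∀ {n} (i : Fin (suc n)) σ → IsPerm σ → FixedAt σ i → Vec (Fin n) n
removeFixed i σ perm fix = tabulate (λ x → punchOut (avoids-fixed σ perm fix x))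

removeFixed-inserts : ∀ {n} (i : Fin (suc n)) σ (perm : IsPerm σ) (fix : FixedAt σ i) →
                      InsertsFixed i (removeFixed i σ perm fix) σ
removeFixed-inserts i σ perm fix =
  inserting fix λ x → trans (sym (punchIn-punchOut _)) (cong (punchIn i) (sym (lookup∘tabulate _ x)))

module _ {n} {i : Fin (suc n)} {π : Vec (Fin n) n} {σ} (ins : InsertsFixed i π σ) where
  open InsertsFixed ins

  inserts-perm : IsPerm π → IsPerm σ
  inserts-perm perm x y σx≡σy with pivot-or-punched i x | pivot-or-punched i y
  ... | inj₁ refl | inj₁ refl = refl
  ... | inj₁ refl | inj₂ (y′ , refl) =
    ⊥-elim (punchInᵢ≢i i (lookup π y′) (trans (sym (shift y′)) (trans (sym σx≡σy) fix)))
  ... | inj₂ (x′ , refl) | inj₁ refl =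
    ⊥-elim (punchInᵢ≢i i (lookup π x′) (trans (sym (shift x′)) (trans σx≡σy fix)))
  ... | inj₂ (x′ , refl) | inj₂ (y′ , refl) =
    cong (punchIn i) (perm x′ y′ (punchIn-injective i _ _ (trans (sym (shift x′)) (trans σx≡σy (shift y′)))))

  inserts-perm⁻¹ : IsPerm σ → IsPerm π
  inserts-perm⁻¹ perm x y πx≡πy =
    punchIn-injective i x y (perm _ _ (trans (shift x) (trans (cong (punchIn i) πx≡πy) (sym (shift y)))))

  inserts-fixed : ∀ x → FixedAt π x → FixedAt σ (punchIn i x)
  inserts-fixed x πx≡x = trans (shift x) (cong (punchIn i) πx≡x)

  inserts-fixed⁻¹ : ∀ x → FixedAt σ (punchIn i x) → FixedAt π x
  inserts-fixed⁻¹ x σx≡x = punchIn-injective i _ _ (trans (sym (shift x)) σx≡x)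

  inserts-unique-left : ∀ {π′} → InsertsFixed i π′ σ → π ≡ π′
  inserts-unique-left {π′} ins′ =
    lookup-ext π π′ (λ x → punchIn-injective i _ _ (trans (sym (shift x)) (InsertsFixed.shift ins′ x)))

  inserts-unique-right : ∀ {σ′} → InsertsFixed i π σ′ → σ ≡ σ′
  inserts-unique-right {σ′} ins′ = lookup-ext σ σ′ same
    where
      same : ∀ x → lookup σ x ≡ lookup σ′ x
      same x with pivot-or-punched i x
      ... | inj₁ refl = trans fix (sym (InsertsFixed.fix ins′))
      ... | inj₂ (x′ , refl) = trans (shift x′) (sym (InsertsFixed.shift ins′ x′))

  below-pivot : ∀ y → toℕ (lookup π y) < toℕ i → lookup σ (punchIn i y) Fin.< lookup σ i
  below-pivot y πy<i = subst₂ Fin._<_ (sym (shift y)) (sym fix) (punchIn-below i (lookup π y) πy<i)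

  below-pivot⁻¹ : ∀ y → lookup σ (punchIn i y) Fin.< lookup σ i → toℕ (lookup π y) < toℕ i
  below-pivot⁻¹ y σy<σi = punchIn-below⁻¹ i (lookup π y) (subst₂ Fin._<_ (shift y) fix σy<σi)

  above-pivot : ∀ x → toℕ i ≤ toℕ (lookup π x) → lookup σ i Fin.< lookup σ (punchIn i x)
  above-pivot x i≤πx = subst₂ Fin._<_ (sym fix) (sym (shift x)) (punchIn-above i (lookup π x) i≤πx)

  above-pivot⁻¹ : ∀ x → lookup σ i Fin.< lookup σ (punchIn i x) → toℕ i ≤ toℕ (lookup π x)
  above-pivot⁻¹ x σi<σx = punchIn-above⁻¹ i (lookup π x) (subst₂ Fin._<_ fix (shift x) σi<σx)

  shifted-< : ∀ x y → lookup π y Fin.< lookup π x → lookup σ (punchIn i y) Fin.< lookup σ (punchIn i x)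
  shifted-< x y πy<πx = subst₂ Fin._<_ (sym (shift y)) (sym (shift x)) (punchIn-mono-< i _ _ πy<πx)

  shifted-<⁻¹ : ∀ x y → lookup σ (punchIn i y) Fin.< lookup σ (punchIn i x) → lookup π y Fin.< lookup π x
  shifted-<⁻¹ x y σy<σx = punchIn-cancel-< i _ _ (subst₂ Fin._<_ (shift y) (shift x) σy<σx)

-- D_j and D*_j for an arbitrary labelling b of the positions by blocks
-- (for b = blockOf a these are, definitionally, InD a j and InD* a j).
InDBy : (ℕ → ℕ) → ℕ → ∀ {N} → Vec (Fin N) N → Set
InDBy b j π = (IsPerm π × DescendingBy b π) × (∀ i → b (toℕ i) ≤ j → ¬ FixedAt π i)

InD*By : (ℕ → ℕ) → ℕ → ∀ {N} → Vec (Fin N) N → Set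
InD*By b j σ = (IsPerm σ × DescendingBy b σ) × (∀ i → b (toℕ i) < j → ¬ FixedAt σ i) ×
               (∃ λ i → b (toℕ i) ≡ j × FixedAt σ i)

-- b labels the positions [0, n) and b′ the positions [0, n]; b′ arises from b by lengthening
-- the run [c, c + m) of label j by one position, to [c, c + m], and is monotone.
module BlockInsertion
  (n : ℕ) (b b′ : ℕ → ℕ) (j c m : ℕ)
  (b′-before  : ∀ i → i < c + m → b′ i ≡ b i)
  (b′-after   : ∀ i → c ≤ i → b′ (suc i) ≡ b i)
  (b′-block   : ∀ p → c ≤ p → p ≤ c + m → b′ p ≡ j)
  (b′-block⁻¹ : ∀ p → b′ p ≡ j → c ≤ p × p ≤ c + m)
  (b′-mono    : ∀ {p q} → p ≤ q → b′ p ≤ b′ q)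
  (block-fits : c + m ≤ n)
  where

  b-block : ∀ i → c ≤ i → i < c + m → b i ≡ j
  b-block i c≤i i<e = trans (sym (b′-before i i<e)) (b′-block i c≤i (<⇒≤ i<e))

  b′-punchIn : ∀ (p : Fin (suc n)) x → c ≤ toℕ p → toℕ p ≤ c + m → b′ (toℕ (punchIn p x)) ≡ b (toℕ x)
  b′-punchIn p x c≤p p≤e with punchIn-cases p x
  ... | inj₁ (x<p , eq) rewrite eq = b′-before (toℕ x) (<-≤-trans x<p p≤e)
  ... | inj₂ (p≤x , eq) rewrite eq = b′-after (toℕ x) (≤-trans c≤p p≤x)

  Slot : Vec (Fin n) n → ℕ → Set
  Slot π Q = c ≤ Q × Q ≤ c + m × (∀ i → c ≤ i → i < Q → i < val π i) × (Q < c + m → val π Q < Q)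

  -- The slot is unique: at an earlier slot P we would have both π_P < P and π_P > P.
  slot-≮ : ∀ π {P Q} → Slot π P → Slot π Q → P ≮ Q
  slot-≮ π (c≤P , _ , _ , atP) (_ , Q≤e , beforeQ , _) P<Q =
    <-asym (beforeQ _ c≤P P<Q) (atP (<-≤-trans P<Q Q≤e))

  slot-unique : ∀ π {P Q} → Slot π P → Slot π Q → P ≡ Q
  slot-unique π slotP slotQ = ≤-antisym (≮⇒≥ (slot-≮ π slotQ slotP)) (≮⇒≥ (slot-≮ π slotP slotQ))

  -- A permutation without fixed points in the block has a slot: the first i with π_i < i.
  slot-exists : ∀ π → (∀ x → b (toℕ x) ≤ j → ¬ FixedAt π x) → ∃ (Slot π)
  slot-exists π no-fixed with first-or-end (λ i → val π i < i) (λ i → val π i <? i) m c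
  ... | Q , c≤Q , Q≤m+c , not-below , below =
    Q , c≤Q , Q≤c+m , above , (λ Q<c+m → below (subst (Q <_) (+-comm c m) Q<c+m))
    where
      Q≤c+m = subst (Q ≤_) (+-comm m c) Q≤m+c
      not-fixed : ∀ i → c ≤ i → i < c + m → i ≢ val π i
      not-fixed i c≤i i<e i≡πi =
        no-fixed (fromℕ< i<n) (≤-reflexive (trans (cong b (toℕ-fromℕ< i<n)) (b-block i c≤i i<e)))
          (toℕ-injective (trans (sym (val-fromℕ< π i<n)) (trans (sym i≡πi) (sym (toℕ-fromℕ< i<n)))))
        where i<n = <-≤-trans i<e block-fits
      above : ∀ i → c ≤ i → i < Q → i < val π i
      above i c≤i i<Q = ≤∧≢⇒< (≮⇒≥ (not-below i c≤i i<Q)) (not-fixed i c≤i (<-≤-trans i<Q Q≤c+m))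

  block-run : ∀ (σ : Vec (Fin (suc n)) (suc n)) → DescendingBy b′ σ →
              ∀ x y → c ≤ x → x < y → y ≤ c + m → val σ y < val σ x
  block-run σ desc = run-antitone (val σ) c (c + m) step
    where
      step : ∀ i → c ≤ i → suc i ≤ c + m → val σ (suc i) < val σ i
      step i c≤i i<e = descending-step b′ σ desc i (s≤s (≤-trans i<e block-fits))
                         (trans (b′-block i c≤i (<⇒≤ i<e)) (sym (b′-block (suc i) (≤-trans c≤i (n≤1+n i)) i<e)))

  fixed-≮ : ∀ σ → DescendingBy b′ σ → ∀ x y → b′ (toℕ x) ≡ j → b′ (toℕ y) ≡ j →
            FixedAt σ x → FixedAt σ y → toℕ x ≮ toℕ y
  fixed-≮ σ desc x y x∈j y∈j fx fy x<y = <-asym x<y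
    (subst₂ _<_ (trans (val-lookup σ y) (cong toℕ fy)) (trans (val-lookup σ x) (cong toℕ fx))
      (block-run σ desc (toℕ x) (toℕ y) (proj₁ (b′-block⁻¹ _ x∈j)) x<y (proj₂ (b′-block⁻¹ _ y∈j))))

  fixed-unique : ∀ σ → DescendingBy b′ σ → ∀ x y → b′ (toℕ x) ≡ j → b′ (toℕ y) ≡ j →
                 FixedAt σ x → FixedAt σ y → x ≡ y
  fixed-unique σ desc x y x∈j y∈j fx fy = toℕ-injective (≤-antisym
    (≮⇒≥ (fixed-≮ σ desc y x y∈j x∈j fy fx)) (≮⇒≥ (fixed-≮ σ desc x y x∈j y∈j fx fy)))

  module _ {q : Fin (suc n)} {π : Vec (Fin n) n} {σ} (ins : InsertsFixed q π σ) where

    -- Inserting the fixed point q at a slot of a descending π gives a descending σ: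
    -- away from q this is the descent of π, next to q it is the slot condition.
    descending-insert : DescendingBy b π → Slot π (toℕ q) → DescendsAdjacent b′ σ
    descending-insert desc (c≤q , q≤e , before , at) u v v≡u+1 same
      with pivot-or-punched q u | pivot-or-punched q v
    ... | inj₁ refl | inj₁ refl = ⊥-elim (1+n≢n (sym v≡u+1))
    ... | inj₁ refl | inj₂ (y , refl) = below-pivot ins y (subst (_< toℕ q) πq≡πy (at q<e))
      where
        πq≡πy = trans (cong (val π) (sym (punchIn-after-pivot q y v≡u+1))) (val-lookup π y)
        q<e = subst (_≤ c + m) v≡u+1 (proj₂ (b′-block⁻¹ _ (trans (sym same) (b′-block _ c≤q q≤e))))
    ... | inj₂ (x , refl) | inj₁ refl =
      above-pivot ins x (subst₂ _≤_ (sym q≡x+1) (val-lookup π x) (before (toℕ x) c≤x (≤-reflexive (sym q≡x+1))))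
      where
        px≡x = punchIn-before-pivot q x v≡u+1
        q≡x+1 = trans v≡u+1 (cong suc px≡x)
        c≤x = subst (c ≤_) px≡x (proj₁ (b′-block⁻¹ _ (trans same (b′-block _ c≤q q≤e))))
    ... | inj₂ (x , refl) | inj₂ (y , refl) = shifted-< ins x y
      (descending⇒adjacent b π desc x y (punchIn-adjacent⁻¹ q x y v≡u+1)
        (trans (sym (b′-punchIn q x c≤q q≤e)) (trans same (b′-punchIn q y c≤q q≤e))))

    descending-remove : b′ (toℕ q) ≡ j → DescendingBy b′ σ → DescendsAdjacent b π
    descending-remove q∈j desc = removed
      where
        c≤q = proj₁ (b′-block⁻¹ _ q∈j)
        q≤e = proj₂ (b′-block⁻¹ _ q∈j)
        σ-desc = descending⇒adjacent b′ σ desc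
        removed : DescendsAdjacent b π
        removed x y y≡x+1 same with punchIn-adjacent q x y y≡x+1
        ... | inj₁ adjacent = shifted-<⁻¹ ins x y (σ-desc _ _ adjacent
              (trans (b′-punchIn q x c≤q q≤e) (trans same (sym (b′-punchIn q y c≤q q≤e)))))
        ... | inj₂ (x+1≡q , y≡q+1) = shifted-<⁻¹ ins x y
              (<-trans (σ-desc q _ y≡q+1 (trans (sym ℓx≡ℓq) ℓx≡ℓy)) (σ-desc _ q (sym x+1≡q) ℓx≡ℓq))
          where
            -- x and y straddle q in σ; by monotonicity of b′ all three carry the same label
            ℓx≡ℓy = trans (b′-punchIn q x c≤q q≤e) (trans same (sym (b′-punchIn q y c≤q q≤e)))
            ℓx≤ℓq = b′-mono (≤-trans (n≤1+n _) (≤-reflexive x+1≡q))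
            ℓq≤ℓy = b′-mono (≤-trans (n≤1+n _) (≤-reflexive (sym y≡q+1)))
            ℓx≡ℓq = ≤-antisym ℓx≤ℓq (≤-trans ℓq≤ℓy (≤-reflexive (sym ℓx≡ℓy)))

    -- ... and q is a slot of π: the entries of σ before q exceed σ_q = q, the one after is below.
    slot-remove : b′ (toℕ q) ≡ j → DescendingBy b′ σ → Slot π (toℕ q)
    slot-remove q∈j desc = c≤q , q≤e , before , at
      where
        c≤q = proj₁ (b′-block⁻¹ _ q∈j)
        q≤e = proj₂ (b′-block⁻¹ _ q∈j)
        before : ∀ i → c ≤ i → i < toℕ q → i < val π i
        before i c≤i i<q = <-≤-trans i<q (subst (toℕ q ≤_) (sym (val-fromℕ< π i<n)) (above-pivot⁻¹ ins x q<σx))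
          where
            i<n = <-≤-trans i<q (≤-trans q≤e block-fits)
            x = fromℕ< i<n
            px≡i = trans (punchIn-low q x (subst (_< toℕ q) (sym (toℕ-fromℕ< i<n)) i<q)) (toℕ-fromℕ< i<n)
            q<σx : toℕ (lookup σ q) < toℕ (lookup σ (punchIn q x))
            q<σx = subst₂ _<_ (val-lookup σ q) (trans (cong (val σ) (sym px≡i)) (val-lookup σ _))
                     (block-run σ desc i (toℕ q) c≤i i<q q≤e)
        at : toℕ q < c + m → val π (toℕ q) < toℕ q
        at q<e = subst (_< toℕ q) (sym (val-fromℕ< π q<n)) (below-pivot⁻¹ ins x σx<q)
          where
            q<n = <-≤-trans q<e block-fits
            x = fromℕ< q<n
            px≡q+1 = trans (punchIn-high q x (≤-reflexive (sym (toℕ-fromℕ< q<n)))) (cong suc (toℕ-fromℕ< q<n))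
            σx<q : toℕ (lookup σ (punchIn q x)) < toℕ (lookup σ q)
            σx<q = subst₂ _<_ (trans (cong (val σ) (sym px≡q+1)) (val-lookup σ _)) (val-lookup σ q)
                     (block-run σ desc (toℕ q) (suc (toℕ q)) c≤q (n<1+n _) q<e)

    insert-D* : InDBy b j π → Slot π (toℕ q) → InD*By b′ j σ
    insert-D* ((perm , desc) , no-fixed) slot@(c≤q , q≤e , _) =
      (inserts-perm ins perm , adjacent⇒descending b′ σ (descending-insert desc slot)) ,
      no-fixed-before , (q , b′-block _ c≤q q≤e , InsertsFixed.fix ins)
      where
        no-fixed-before : ∀ u → b′ (toℕ u) < j → ¬ FixedAt σ u
        no-fixed-before u ℓu<j fixed with pivot-or-punched q u
        ... | inj₁ refl = <-irrefl (b′-block _ c≤q q≤e) ℓu<j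
        ... | inj₂ (x , refl) = no-fixed x (<⇒≤ (subst (_< j) (b′-punchIn q x c≤q q≤e) ℓu<j))
                                  (inserts-fixed⁻¹ ins x fixed)

    remove-D : InD*By b′ j σ → b′ (toℕ q) ≡ j → InDBy b j π
    remove-D ((perm , desc) , no-fixed-before , _) q∈j =
      (inserts-perm⁻¹ ins perm , adjacent⇒descending b π (descending-remove q∈j desc)) , no-fixed
      where
        c≤q = proj₁ (b′-block⁻¹ _ q∈j)
        q≤e = proj₂ (b′-block⁻¹ _ q∈j)
        -- a fixed point x of π gives the fixed point punchIn q x ≠ q of σ, with the same label
        no-fixed : ∀ x → b (toℕ x) ≤ j → ¬ FixedAt π x
        no-fixed x ℓx≤j fixed with m≤n⇒m<n∨m≡n (subst (_≤ j) (sym (b′-punchIn q x c≤q q≤e)) ℓx≤j)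
        ... | inj₁ ℓ<j = no-fixed-before _ ℓ<j (inserts-fixed ins x fixed)
        ... | inj₂ ℓ≡j = punchInᵢ≢i q x
              (fixed-unique σ desc _ q ℓ≡j q∈j (inserts-fixed ins x fixed) (InsertsFixed.fix ins))

  slotOf : ∀ π → InDBy b j π → Fin (suc n)
  slotOf π dπ = fromℕ< (s≤s (≤-trans (proj₁ (proj₂ (proj₂ (slot-exists π (proj₂ dπ))))) block-fits))

  slotOf-slot : ∀ π (dπ : InDBy b j π) → Slot π (toℕ (slotOf π dπ))
  slotOf-slot π dπ = subst (Slot π) (sym (toℕ-fromℕ< _)) (proj₂ (slot-exists π (proj₂ dπ)))

  to : Subset (InDBy b j {n}) → Subset (InD*By b′ j {suc n})
  to (π , dπ) = insertFixed q π , insert-D* (insertFixed-inserts q π) dπ (slotOf-slot π dπ)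
    where q = slotOf π dπ

  from : Subset (InD*By b′ j {suc n}) → Subset (InDBy b j {n})
  from (σ , dσ@((perm , _) , _ , (q , q∈j , fix))) =
    removeFixed q σ perm fix , remove-D (removeFixed-inserts q σ perm fix) dσ q∈j

  bijection : Bij (InDBy b j {n}) (InD*By b′ j {suc n})
  bijection = record { to = to ; from = from ; from∘to = from∘to ; to∘from = to∘from }
    where
      from∘to : ∀ x → proj₁ (from (to x)) ≡ proj₁ x
      from∘to (π , dπ) = inserts-unique-left (removeFixed-inserts q σ perm (InsertsFixed.fix inserted)) inserted
        where
          q = slotOf π dπ
          σ = insertFixed q π
          inserted = insertFixed-inserts q π
          perm = inserts-perm inserted (proj₁ (proj₁ dπ))

      -- the slot of the reduced permutation is the deleted fixed point q
      to∘from : ∀ y → proj₁ (to (from y)) ≡ proj₁ y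
      to∘from (σ , dσ@((perm , desc) , _ , (q , q∈j , fix))) = begin
        insertFixed (slotOf π dπ) π ≡⟨ cong (λ p → insertFixed p π) slot≡q ⟩
        insertFixed q π             ≡⟨ inserts-unique-right (insertFixed-inserts q π) removed ⟩
        σ                           ∎
        where
          open ≡-Reasoning
          removed = removeFixed-inserts q σ perm fix
          π = removeFixed q σ perm fix
          dπ = remove-D removed dσ q∈j
          slot≡q = toℕ-injective (slot-unique π (slotOf-slot π dπ) (slot-remove removed q∈j desc))

Bij-cast : ∀ {M} {P : Vec (Fin M) M → Set} (Q : ∀ N → Vec (Fin N) N → Set) {N N′} →
           N ≡ N′ → Bij P (Q N) → Bij P (Q N′)
Bij-cast Q refl bij = bij

lemma1 : ∀ (k : ℕ) (a : Vec ℕ k) (j : Fin k) → Bij (InD a j) (InD* (incAt a j) j)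
lemma1 k a j = Bij-cast (λ N → InD*By (blockOf (incAt a j)) (toℕ j) {N}) (sym (sum-incAt a j))
  (BlockInsertion.bijection (sum a) (blockOf a) (blockOf (incAt a j)) (toℕ j) (blockStart a j) (lookup a j)
    (blockOf-incAt-before a j) (blockOf-incAt-after a j) (incAt-block-inside a j) (incAt-block-range a j)
    (blockOf-mono (incAt a j)) (blockEnd≤sum a j))
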